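{- Let $\ell\ge 2$, let $G$ be a graph with a pendant vertex $p$, let $v$ be the neighbor of $p$ in $G$, and let $G'$ be the subgraph induced by $V(G)\setminus\{p,v\}$. (1) $G$ is $A$-AW if and only if $G'$ is $A$-AW. (2) Let $r\in\mathbb{N}$ be minimum such that $T_{V(G)}^{A(G)}(r)\ne\emptyset$, and let $t\in T_{V(G)}^{A(G)}(r)$. Then $\overline{G}$ is $N$-AW if and only if both of the following hold: (a) for each labeling $\pi$ of $V(G)$ there is some $s\in\mathbb{Z}_\ell$ such that $\pi_s$ is $A(G)$-winnable; (b) for each $z\in\mathbb{Z}_\ell$ there exists $q\in T_{V(G)}^{A(G)}(0)$ such that the congruence $(r+t)x\equiv z+q\pmod{\ell}$ has a solution $x$.
   Context: All graphs are finite and simple; labels lie in $\mathbb{Z}_\ell$. For a square matrix $M=[m_{ij}]$ over $\mathbb{Z}_\ell$ indexed by a vertex set $V(M)=\{v_1,\dots,v_n\}$, the $M$-Lights Out game is: each vertex carries a label in $\mathbb{Z}_\ell$; toggling $v_j$ adds $m_{ij}$ to the label of $v_i$ for every $i$; the game is won when all labels are $0$. A labeling is $M$-winnable if the game can be won from it. For a graph, $A(G)$ is the adjacency matrix and $N(G)$ the neighborhood matrix (adjacency matrix plus identity); $G$ is $A$-AW (resp. $N$-AW) if every labeling of $V(G)$ is $A(G)$-winnable (resp. $N(G)$-winnable). For a labeling $\pi$ and $s\in\mathbb{Z}_\ell$, $\pi_s$ is the labeling $v\mapsto\pi(v)+s$. For $U\subseteq V(M)$ and $r\in\mathbb{Z}_\ell$,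 $\mathbf{0}_{U,r}$ is the labeling that is $r$ on $U$ and $0$ elsewhere, and the set $T_U^M(r)\subseteq\mathbb{Z}_\ell$ consists of all $t$ such that the $M$-Lights Out game with initial labeling $\mathbf{0}_{U,r}$ can be won with the vertices of $U$ toggled collectively $t$ times (mod $\ell$). $\overline{G}$ is the complement of $G$. -}

module Defs where

open import Data.Bool using (Bool; true; false; not; _∧_; if_then_else_)
open import Data.Nat using (ℕ; zero; suc; _≤_; _<_)
open import Data.Integer using (ℤ; +_; _+_; _-_; _*_)
open import Data.Integer.Divisibility using (_∣_)
open import Data.Fin using (Fin; zero; suc)
open import Data.Fin.Properties using (_≟_)
open import Data.Product using (Σ; ∃; _×_; _,_)
open import Relation.Nullary using (¬_)
open import Relation.Nullary.Decidable using (⌊_⌋)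
open import Relation.Binary.PropositionalEquality using (_≡_)
open import Function using (Injective)

-- Elements of ℤ_ℓ are represented by integers; equality in ℤ_ℓ is congruence mod ℓ.
_≡_[mod_] : ℤ → ℤ → ℕ → Set
a ≡ b [mod ℓ ] = (+ ℓ) ∣ (a - b)

sumFin : (n : ℕ) → (Fin n → ℤ) → ℤ
sumFin zero    f = + 0
sumFin (suc n) f = f zero + sumFin n (λ i → f (suc i))

Mat : ℕ → Set
Mat n = Fin n → Fin n → ℤ

Labeling : ℕ → Set
Labeling n = Fin n → ℤ

-- Effect of toggling vertex j exactly x j times: label i gains Σ_j m_ij x_j.
-- π is M-winnable (over ℤ_ℓ) iff some toggling makes every label 0 mod ℓ.
Winnable : (ℓ : ℕ) {n : ℕ} → Mat n → Labeling n → Set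
Winnable ℓ {n} M π =
  ∃ λ (x : Fin n → ℤ) → ∀ i → (π i + sumFin n (λ j → M i j * x j)) ≡ + 0 [mod ℓ ]

AllWinnable : (ℓ : ℕ) {n : ℕ} → Mat n → Set
AllWinnable ℓ {n} M = ∀ (π : Labeling n) → Winnable ℓ M π

record Graph (n : ℕ) : Set where
  field
    adj   : Fin n → Fin n → Bool
    adj-sym : ∀ i j → adj i j ≡ adj j i
    adj-irr : ∀ i → adj i i ≡ false
open Graph public

boolℤ : Bool → ℤ
boolℤ true  = + 1
boolℤ false = + 0

A : {n : ℕ} → Graph n → Mat n
A G i j = boolℤ (adj G i j)

N : {n : ℕ} → Graph n → Mat n
N G i j = boolℤ (adj G i j) + boolℤ ⌊ i ≟ j ⌋

A-AW : (ℓ : ℕ) {n : ℕ} → Graph n → Set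
A-AW ℓ G = AllWinnable ℓ (A G)

N-AW : (ℓ : ℕ) {n : ℕ} → Graph n → Set
N-AW ℓ G = AllWinnable ℓ (N G)

complement : {n : ℕ} → Graph n → Graph n
complement {n} G = record
  { adj = λ i j → not (adj G i j) ∧ not ⌊ i ≟ j ⌋
  ; adj-sym = symc
  ; adj-irr = irrc }
  where
  open import Relation.Binary.PropositionalEquality using (refl; cong₂; sym)
  open import Relation.Nullary using (yes; no)
  symc : ∀ i j → (not (adj G i j) ∧ not ⌊ i ≟ j ⌋) ≡ (not (adj G j i) ∧ not ⌊ j ≟ i ⌋)
  symc i j with i ≟ j | j ≟ i
  ... | yes p | yes q = cong₂ _∧_ (Relation.Binary.PropositionalEquality.cong not (adj-sym G i j)) refl
  ... | no p  | no q  = cong₂ _∧_ (Relation.Binary.PropositionalEquality.cong not (adj-sym G i j)) refl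
  ... | yes p | no q  = Data.Empty.⊥-elim (q (sym p))
    where import Data.Empty
  ... | no p  | yes q = Data.Empty.⊥-elim (p (sym q))
    where import Data.Empty
  irrc : ∀ i → (not (adj G i i) ∧ not ⌊ i ≟ i ⌋) ≡ false
  irrc i with i ≟ i
  ... | yes _ = Data.Bool.Properties.∧-zeroʳ (not (adj G i i))
    where import Data.Bool.Properties
  ... | no q  = Data.Empty.⊥-elim (q refl)
    where import Data.Empty

induced : {n m : ℕ} → Graph n → (e : Fin m → Fin n) → Graph m
induced G e = record
  { adj = λ i j → adj G (e i) (e j)
  ; adj-sym = λ i j → adj-sym G (e i) (e j)
  ; adj-irr = λ i → adj-irr G (e i) }

zeroLab : {n : ℕ} → (Fin n → Bool) → ℤ → Labeling n
zeroLab U r i = if U i then r else + 0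

-- t ∈ T_U^M(r): the game from 0_{U,r} can be won with the vertices of U
-- toggled collectively t times (mod ℓ).
InT : (ℓ : ℕ) {n : ℕ} → Mat n → (Fin n → Bool) → ℤ → ℤ → Set
InT ℓ {n} M U r t =
  ∃ λ (x : Fin n → ℤ) →
    (∀ i → (zeroLab U r i + sumFin n (λ j → M i j * x j)) ≡ + 0 [mod ℓ ])
    × (sumFin n (λ j → if U j then x j else + 0) ≡ t [mod ℓ ])

allV : {n : ℕ} → Fin n → Bool
allV _ = true

TNonempty : (ℓ : ℕ) {n : ℕ} → Mat n → (Fin n → Bool) → ℤ → Set
TNonempty ℓ M U r = ∃ λ t → InT ℓ M U r t

PendantWithNeighbor : {n : ℕ} → Graph n → Fin n → Fin n → Set
PendantWithNeighbor G p v = (adj G p v ≡ true) × (∀ w → adj G p w ≡ true → w ≡ v)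

EnumeratesWithout : {n m : ℕ} → (Fin m → Fin n) → Fin n → Fin n → Set
EnumeratesWithout {n} {m} e p v =
  Injective _≡_ _≡_ e
  × (∀ i → ¬ (e i ≡ p) × ¬ (e i ≡ v))
  × (∀ w → ¬ (w ≡ p) → ¬ (w ≡ v) → ∃ λ i → e i ≡ w)

shift : {n : ℕ} → Labeling n → ℤ → Labeling n
shift π s i = π i + s

-- A pendant vertex p pins down the toggle count of its neighbour: the equation at p
-- reads π(p) + x_v = 0. Given x_v, the equations at V(G) ∖ {p, v} form the A(G′)-game
-- with labels shifted by A(w, v) x_v, and the equation at v is met by choosing x_p,
-- which occurs in no other equation.
--
-- For the complement, N(Ḡ) = J - A(G), so toggling y in the N(Ḡ)-game from π acts as
-- toggling -y in the A(G)-game from π shifted by Σ y. So N(Ḡ) asks for an A(G)-solution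
-- x of some shift π_s with s + Σ x ≡ 0. Condition (a) supplies a solution of some shift;
-- adding k copies of a solution for the constant labeling r (of total t) and removing a
-- solution for 0 (of total q) changes s + Σ x by k (r + t) - q, and (b) says that this
-- correction can cancel any z. Conversely, a constant labeling d is A(G)-winnable only
-- when r ∣ d: removing ⌊d/r⌋ copies of the solution for r wins d mod r, which the
-- minimality of r forbids unless it is 0.

module Submission where

open import Defs
open import Data.Nat as ℕ using (ℕ; zero; suc; _≤_; _<_; s≤s; z≤n)
open import Data.Integer.DivMod using (_%ℕ_; _/ℕ_; n%ℕd<d; a≡a%ℕn+[a/ℕn]*n)
open import Data.Empty using (⊥-elim)
open import Relation.Nullary using (¬_; yes; no)
open import Data.Bool using (true; false)
open import Data.Fin.Properties using (_≟_)
open import Data.Integer using (ℤ; +_; _+_; _*_; _-_; -_; -1ℤ)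
import Data.Integer.Properties as ℤ
import Data.Integer.Divisibility.Signed as Signed
open import Data.Fin using (Fin; zero; suc)
open import Data.Fin.Permutation using (Permutation; _⟨$⟩ʳ_; permutation)
open import Data.Product using (∃; _×_; _,_; proj₁; proj₂)
open import Relation.Binary.Bundles using (Setoid)
open import Level using (0ℓ)
import Relation.Binary.Reasoning.Setoid
open import Relation.Binary.PropositionalEquality
open import Data.Integer.Tactic.RingSolver using (solve-∀)
open import Data.Vec.Functional using (_∷_)
open import Function.Bundles using (_⇔_; mk⇔; Equivalence)
open import Function.Definitions using (Injective)
open import Algebra.Properties.Semiring.Sum ℤ.+-*-semiring
  using (sum; sum-cong-≗; sum-permute; sum-replicate-zero; ∑-distrib-+; *-distribˡ-sum)

sumFin≡sum : ∀ n (f : Fin n → ℤ) → sumFin n f ≡ sum f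
sumFin≡sum zero    f = refl
sumFin≡sum (suc n) f = cong (_+_ (f zero)) (sumFin≡sum n (λ i → f (suc i)))

sumFin-cong : ∀ n {f g : Fin n → ℤ} → (∀ j → f j ≡ g j) → sumFin n f ≡ sumFin n g
sumFin-cong zero    f≗g = refl
sumFin-cong (suc n) f≗g = cong₂ _+_ (f≗g zero) (sumFin-cong n (λ j → f≗g (suc j)))

sumFin-zero : ∀ n → sumFin n (λ _ → + 0) ≡ + 0
sumFin-zero n = trans (sumFin≡sum n _) (sum-replicate-zero n)

sumFin-linear : ∀ n a b (f g : Fin n → ℤ) →
  sumFin n (λ j → a * f j + b * g j) ≡ a * sumFin n f + b * sumFin n g
sumFin-linear n a b f g = begin
  sumFin n (λ j → a * f j + b * g j)               ≡⟨ sumFin≡sum n _ ⟩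
  sum (λ j → a * f j + b * g j)                    ≡⟨ ∑-distrib-+ (λ j → a * f j) (λ j → b * g j) ⟩
  sum (λ j → a * f j) + sum (λ j → b * g j)        ≡⟨ cong₂ _+_ (*-distribˡ-sum a f) (*-distribˡ-sum b g) ⟨
  a * sum f + b * sum g                            ≡⟨ cong₂ (λ u w → a * u + b * w) (sumFin≡sum n f) (sumFin≡sum n g) ⟨
  a * sumFin n f + b * sumFin n g                  ∎
  where open ≡-Reasoning

sumFin-neg : ∀ n (f : Fin n → ℤ) → sumFin n (λ j → - f j) ≡ - sumFin n f
sumFin-neg n f = begin
  sumFin n (λ j → - f j)   ≡⟨ trans (sumFin≡sum n _) (sum-cong-≗ (λ j → sym (ℤ.-1*i≡-i (f j)))) ⟩
  sum (λ j → -1ℤ * f j)    ≡⟨ *-distribˡ-sum -1ℤ f ⟨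
  -1ℤ * sum f              ≡⟨ ℤ.-1*i≡-i (sum f) ⟩
  - sum f                  ≡⟨ cong -_ (sumFin≡sum n f) ⟨
  - sumFin n f             ∎
  where open ≡-Reasoning

sumFin-permute : ∀ {m n} (f : Fin n → ℤ) (σ : Permutation m n) →
  sumFin n f ≡ sumFin m (λ i → f (σ ⟨$⟩ʳ i))
sumFin-permute {m} {n} f σ = begin
  sumFin n f                   ≡⟨ sumFin≡sum n f ⟩
  sum f                        ≡⟨ sum-permute f σ ⟩
  sum (λ i → f (σ ⟨$⟩ʳ i))     ≡⟨ sumFin≡sum m _ ⟨
  sumFin m (λ i → f (σ ⟨$⟩ʳ i)) ∎
  where open ≡-Reasoning

module Congruence (ℓ : ℕ) where

  -- A record rather than a synonym, so that a and b can be inferred from a proof of a ≈ b.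
  infix 4 _≈_
  record _≈_ (a b : ℤ) : Set where
    constructor mod
    field unmod : a ≡ b [mod ℓ ]
  open _≈_ public

  private
    via : ∀ {a b c} → c ≡ a - b → + ℓ Signed.∣ c → a ≈ b
    via eq ℓ∣c = mod (Signed.∣⇒∣ᵤ (subst (+ ℓ Signed.∣_) eq ℓ∣c))

    diff : ∀ {a b} → a ≈ b → + ℓ Signed.∣ a - b
    diff a≈b = Signed.∣ᵤ⇒∣ (unmod a≈b)

    self-diff : ∀ a k → + 0 * k ≡ a - a
    self-diff = solve-∀
    neg-diff : ∀ a b → - (a - b) ≡ b - a
    neg-diff = solve-∀
    chain-diff : ∀ a b c → (a - b) + (b - c) ≡ a - c
    chain-diff = solve-∀
    sum-diff : ∀ a b c d → (a - b) + (c - d) ≡ (a + c) - (b + d)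
    sum-diff = solve-∀
    scale-diff : ∀ k a b → k * (a - b) ≡ k * a - k * b
    scale-diff = solve-∀

  ≈-refl : ∀ {a} → a ≈ a
  ≈-refl {a} = via (self-diff a (+ ℓ)) (Signed.divides (+ 0) refl)

  ≈-reflexive : ∀ {a b} → a ≡ b → a ≈ b
  ≈-reflexive refl = ≈-refl

  ≈-sym : ∀ {a b} → a ≈ b → b ≈ a
  ≈-sym {a} {b} a≈b = via (neg-diff a b) (Signed.∣m⇒∣-m (diff a≈b))

  ≈-trans : ∀ {a b c} → a ≈ b → b ≈ c → a ≈ c
  ≈-trans {a} {b} {c} a≈b b≈c = via (chain-diff a b c) (Signed.∣m∣n⇒∣m+n (diff a≈b) (diff b≈c))

  +-cong : ∀ {a b c d} → a ≈ b → c ≈ d → a + c ≈ b + d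
  +-cong {a} {b} {c} {d} a≈b c≈d = via (sum-diff a b c d) (Signed.∣m∣n⇒∣m+n (diff a≈b) (diff c≈d))

  *-congˡ : ∀ k {a b} → a ≈ b → k * a ≈ k * b
  *-congˡ k {a} {b} a≈b = via (scale-diff k a b) (Signed.∣n⇒∣m*n k (diff a≈b))

  ≈-setoid : Setoid 0ℓ 0ℓ
  ≈-setoid = record
    { Carrier       = ℤ
    ; _≈_           = _≈_
    ; isEquivalence = record { refl = ≈-refl ; sym = ≈-sym ; trans = ≈-trans }
    }

  module ≈-Reasoning = Relation.Binary.Reasoning.Setoid ≈-setoid

infixl 7 _·_
_·_ : ∀ {n} → Mat n → (Fin n → ℤ) → Fin n → ℤ
_·_ {n} M x i = sumFin n (λ j → M i j * x j)

·-cong : ∀ {n} (M : Mat n) {x y : Fin n → ℤ} → (∀ j → x j ≡ y j) → ∀ i → (M · x) i ≡ (M · y) i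
·-cong {n} M x≗y i = sumFin-cong n (λ j → cong (M i j *_) (x≗y j))

·-linear : ∀ {n} (M : Mat n) a b (x y : Fin n → ℤ) i →
  (M · (λ j → a * x j + b * y j)) i ≡ a * (M · x) i + b * (M · y) i
·-linear {n} M a b x y i = begin
  sumFin n (λ j → M i j * (a * x j + b * y j))          ≡⟨ sumFin-cong n (λ j → distribute a b (M i j) (x j) (y j)) ⟩
  sumFin n (λ j → a * (M i j * x j) + b * (M i j * y j)) ≡⟨ sumFin-linear n a b _ _ ⟩
  a * (M · x) i + b * (M · y) i                          ∎
  where
  open ≡-Reasoning
  distribute : ∀ a b m u w → m * (a * u + b * w) ≡ a * (m * u) + b * (m * w)
  distribute = solve-∀

·-neg : ∀ {n} (M : Mat n) (x : Fin n → ℤ) i → (M · (λ j → - x j)) i ≡ - (M · x) i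
·-neg {n} M x i = begin
  sumFin n (λ j → M i j * - x j)    ≡⟨ sumFin-cong n (λ j → sym (ℤ.neg-distribʳ-* (M i j) (x j))) ⟩
  sumFin n (λ j → - (M i j * x j))  ≡⟨ sumFin-neg n _ ⟩
  - (M · x) i                       ∎
  where open ≡-Reasoning

module Game (ℓ : ℕ) where

  open Congruence ℓ public

  -- A record for the same reason as _≈_.
  record Wins {n} (M : Mat n) (π : Labeling n) (x : Fin n → ℤ) : Set where
    constructor wins
    field won : ∀ i → π i + (M · x) i ≈ + 0
  open Wins public

  Wins⇒Winnable : ∀ {n} {M : Mat n} {π x} → Wins M π x → Winnable ℓ M π
  Wins⇒Winnable {x = x} w = x , λ i → unmod (won w i)

  Winnable⇒Wins : ∀ {n} {M : Mat n} {π} → (winnable : Winnable ℓ M π) → Wins M π (proj₁ winnable)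
  Winnable⇒Wins (_ , w) = wins (λ i → mod (w i))

  InT⇒Wins : ∀ {n} {M : Mat n} {r t} → InT ℓ M allV r t → ∃ λ x → Wins M (λ _ → r) x × sumFin n x ≈ t
  InT⇒Wins (x , w , Σx≡t) = x , wins (λ i → mod (w i)) , mod Σx≡t

  Wins⇒InT : ∀ {n} {M : Mat n} {r x} → Wins M (λ _ → r) x → InT ℓ M allV r (sumFin n x)
  Wins⇒InT {n} {x = x} w = x , (λ i → unmod (won w i)) , unmod (≈-refl {sumFin n x})

  Wins-resp : ∀ {n} {M : Mat n} {π π′ x x′} → (∀ i → π i ≈ π′ i) → (∀ j → x j ≡ x′ j) →
    Wins M π x → Wins M π′ x′
  Wins-resp {M = M} {π} {π′} {x} {x′} π≈π′ x≗x′ w = wins λ i → begin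
    π′ i + (M · x′) i  ≈⟨ +-cong (π≈π′ i) (≈-reflexive (·-cong M x≗x′ i)) ⟨
    π i + (M · x) i    ≈⟨ won w i ⟩
    + 0                ∎
    where open ≈-Reasoning

  Wins-linear : ∀ {n} {M : Mat n} {π π′ x y} a b → Wins M π x → Wins M π′ y →
    Wins M (λ i → a * π i + b * π′ i) (λ j → a * x j + b * y j)
  Wins-linear {M = M} {π} {π′} {x} {y} a b wx wy = wins λ i → begin
    (a * π i + b * π′ i) + (M · (λ j → a * x j + b * y j)) i   ≡⟨ cong (_+_ (a * π i + b * π′ i)) (·-linear M a b x y i) ⟩
    (a * π i + b * π′ i) + (a * (M · x) i + b * (M · y) i)     ≡⟨ regroup a b (π i) (π′ i) ((M · x) i) ((M · y) i) ⟩
    a * (π i + (M · x) i) + b * (π′ i + (M · y) i)             ≈⟨ +-cong (*-congˡ a (won wx i)) (*-congˡ b (won wy i)) ⟩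
    a * + 0 + b * + 0                                          ≡⟨ cong₂ _+_ (ℤ.*-zeroʳ a) (ℤ.*-zeroʳ b) ⟩
    + 0                                                        ∎
    where
    open ≈-Reasoning
    regroup : ∀ a b p p′ u w → (a * p + b * p′) + (a * u + b * w) ≡ a * (p + u) + b * (p′ + w)
    regroup = solve-∀

  Wins-const⇒∣ : ∀ {n} (M : Mat n) {r} → 1 ≤ r →
    (∀ r′ → 1 ≤ r′ → r′ < r → ¬ TNonempty ℓ M allV (+ r′)) →
    ∀ {xr x d} → Wins M (λ _ → + r) xr → Wins M (λ _ → d) x → + r Signed.∣ d
  Wins-const⇒∣ {n} M {r} 1≤r minimal {xr} {x} {d} wr wd =
    by-residue (d %ℕ r) (a≡a%ℕn+[a/ℕn]*n d r) (n%ℕd<d d r)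
    where
    instance
      r≢0 : ℕ.NonZero r
      r≢0 = ℕ.>-nonZero 1≤r
    k : ℤ
    k = d /ℕ r
    by-residue : ∀ ρ → d ≡ + ρ + k * + r → ρ < r → + r Signed.∣ d
    by-residue zero    d≡kr _   = Signed.divides k (trans d≡kr (ℤ.+-identityˡ (k * + r)))
    by-residue (suc ρ) d≡ρ+kr ρ<r =
      ⊥-elim (minimal (suc ρ) (s≤s z≤n) ρ<r (sumFin n x′ , Wins⇒InT residue-wins))
      where
      x′ : Fin n → ℤ
      x′ j = + 1 * x j + - k * xr j
      cancel : ∀ a k r → + 1 * (a + k * r) + - k * r ≡ a
      cancel = solve-∀
      residue : + 1 * d + - k * + r ≡ + suc ρ
      residue = trans (cong (λ e → + 1 * e + - k * + r) d≡ρ+kr) (cancel (+ suc ρ) k (+ r))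
      residue-wins : Wins M (λ _ → + suc ρ) x′
      residue-wins = Wins-resp (λ _ → ≈-reflexive residue) (λ _ → refl) (Wins-linear (+ 1) (- k) wd wr)

module Enumeration {n : ℕ} {p v : Fin n} (p≢v : p ≢ v) {m : ℕ} {e : Fin m → Fin n}
                   (enum : EnumeratesWithout e p v) where

  e-injective : Injective _≡_ _≡_ e
  e-injective = proj₁ enum

  e-avoids : ∀ i → e i ≢ p × e i ≢ v
  e-avoids = proj₁ (proj₂ enum)

  e-covers : ∀ w → w ≢ p → w ≢ v → ∃ λ i → e i ≡ w
  e-covers = proj₂ (proj₂ enum)

  enumerate : Fin (suc (suc m)) → Fin n
  enumerate = p ∷ v ∷ e

  index : Fin n → Fin (suc (suc m))
  index w with w ≟ p | w ≟ v
  ... | yes _   | _       = zero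
  ... | no _    | yes _   = suc zero
  ... | no w≢p  | no w≢v  = suc (suc (proj₁ (e-covers w w≢p w≢v)))

  enumerate-index : ∀ w → enumerate (index w) ≡ w
  enumerate-index w with w ≟ p | w ≟ v
  ... | yes w≡p | _       = sym w≡p
  ... | no _    | yes w≡v = sym w≡v
  ... | no w≢p  | no w≢v  = proj₂ (e-covers w w≢p w≢v)

  index-enumerate : ∀ k → index (enumerate k) ≡ k
  index-enumerate zero with p ≟ p
  ... | yes _   = refl
  ... | no p≢p  = ⊥-elim (p≢p refl)
  index-enumerate (suc zero) with v ≟ p | v ≟ v
  ... | yes v≡p | _       = ⊥-elim (p≢v (sym v≡p))
  ... | no _    | yes _   = refl
  ... | no _    | no v≢v  = ⊥-elim (v≢v refl)
  index-enumerate (suc (suc i)) with e i ≟ p | e i ≟ v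
  ... | yes ei≡p | _        = ⊥-elim (proj₁ (e-avoids i) ei≡p)
  ... | no _     | yes ei≡v = ⊥-elim (proj₂ (e-avoids i) ei≡v)
  ... | no ei≢p  | no ei≢v  = cong (λ j → suc (suc j)) (e-injective (proj₂ (e-covers (e i) ei≢p ei≢v)))

  enumeration : Permutation (suc (suc m)) n
  enumeration = permutation enumerate index enumerate-index index-enumerate

  sumFin-split : ∀ (f : Fin n → ℤ) → sumFin n f ≡ f p + (f v + sumFin m (λ i → f (e i)))
  sumFin-split f = sumFin-permute f enumeration

  extend : ℤ → ℤ → (Fin m → ℤ) → Fin n → ℤ
  extend a b y w = (a ∷ b ∷ y) (index w)

  extend-enumerate : ∀ a b y k → extend a b y (enumerate k) ≡ (a ∷ b ∷ y) k
  extend-enumerate a b y k = cong (a ∷ b ∷ y) (index-enumerate k)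

module Pendant (ℓ : ℕ) {n : ℕ} (G : Graph n) (p v : Fin n) (pendant : PendantWithNeighbor G p v)
               {m : ℕ} {e : Fin m → Fin n} (enum : EnumeratesWithout e p v) where

  open Game ℓ

  p≢v : p ≢ v
  p≢v p≡v with trans (sym (proj₁ pendant)) (trans (cong (adj G p) (sym p≡v)) (adj-irr G p))
  ... | ()

  open Enumeration p≢v enum

  G′ : Graph m
  G′ = induced G e

  A-irrefl : ∀ w → A G w w ≡ + 0
  A-irrefl w = cong boolℤ (adj-irr G w)

  A-pv : A G p v ≡ + 1
  A-pv = cong boolℤ (proj₁ pendant)

  A-vp : A G v p ≡ + 1
  A-vp = trans (cong boolℤ (adj-sym G v p)) A-pv

  A-pe : ∀ i → A G p (e i) ≡ + 0
  A-pe i with adj G p (e i) in p~ei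
  ... | true  = ⊥-elim (proj₂ (e-avoids i) (proj₂ pendant (e i) p~ei))
  ... | false = refl

  A-ep : ∀ i → A G (e i) p ≡ + 0
  A-ep i = trans (cong boolℤ (adj-sym G (e i) p)) (A-pe i)

  ·-row : ∀ x w → (A G · x) w ≡ A G w p * x p + (A G w v * x v + sumFin m (λ i → A G w (e i) * x (e i)))
  ·-row x w = sumFin-split (λ j → A G w j * x j)

  ·-row-p : ∀ x → (A G · x) p ≡ x v
  ·-row-p x = begin
    (A G · x) p                                                    ≡⟨ ·-row x p ⟩
    A G p p * x p + (A G p v * x v + sumFin m (λ i → A G p (e i) * x (e i)))
      ≡⟨ cong₂ (λ a b → a * x p + (b * x v + sumFin m (λ i → A G p (e i) * x (e i)))) (A-irrefl p) A-pv ⟩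
    + 0 * x p + (+ 1 * x v + sumFin m (λ i → A G p (e i) * x (e i)))
      ≡⟨ cong (λ s → + 0 * x p + (+ 1 * x v + s)) (trans (sumFin-cong m (λ i → cong (_* x (e i)) (A-pe i))) (sumFin-zero m)) ⟩
    + 0 * x p + (+ 1 * x v + + 0)                                  ≡⟨ only-v (x p) (x v) ⟩
    x v                                                            ∎
    where
    open ≡-Reasoning
    only-v : ∀ a b → + 0 * a + (+ 1 * b + + 0) ≡ b
    only-v = solve-∀

  ·-row-v : ∀ x → (A G · x) v ≡ x p + sumFin m (λ i → A G v (e i) * x (e i))
  ·-row-v x = begin
    (A G · x) v                                                          ≡⟨ ·-row x v ⟩
    A G v p * x p + (A G v v * x v + S)                                  ≡⟨ cong₂ (λ a b → a * x p + (b * x v + S)) A-vp (A-irrefl v) ⟩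
    + 1 * x p + (+ 0 * x v + S)                                          ≡⟨ only-p (x p) (x v) S ⟩
    x p + S                                                              ∎
    where
    open ≡-Reasoning
    S : ℤ
    S = sumFin m (λ i → A G v (e i) * x (e i))
    only-p : ∀ a b s → + 1 * a + (+ 0 * b + s) ≡ a + s
    only-p = solve-∀

  ·-row-e : ∀ x i → (A G · x) (e i) ≡ A G (e i) v * x v + (A G′ · (λ j → x (e j))) i
  ·-row-e x i = begin
    (A G · x) (e i)                                           ≡⟨ ·-row x (e i) ⟩
    A G (e i) p * x p + (A G (e i) v * x v + S)               ≡⟨ cong (λ a → a * x p + (A G (e i) v * x v + S)) (A-ep i) ⟩
    + 0 * x p + (A G (e i) v * x v + S)                       ≡⟨ drop-p (x p) (A G (e i) v * x v) S ⟩
    A G (e i) v * x v + S                                     ∎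
    where
    open ≡-Reasoning
    S : ℤ
    S = (A G′ · (λ j → x (e j))) i
    drop-p : ∀ a b s → + 0 * a + (b + s) ≡ b + s
    drop-p = solve-∀

  A-AW⇒A-AW-induced : A-AW ℓ G → A-AW ℓ G′
  A-AW⇒A-AW-induced aw π′ = Wins⇒Winnable x∘e-wins
    where
    π : Labeling n
    π = extend (+ 0) (+ 0) π′
    x : Fin n → ℤ
    x = proj₁ (aw π)
    wx : Wins (A G) π x
    wx = Winnable⇒Wins {π = π} (aw π)
    xv≈0 : x v ≈ + 0
    xv≈0 = begin
      x v                  ≡⟨ ℤ.+-identityˡ (x v) ⟨
      + 0 + x v            ≡⟨ cong₂ _+_ (extend-enumerate (+ 0) (+ 0) π′ zero) (·-row-p x) ⟨
      π p + (A G · x) p    ≈⟨ won wx p ⟩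
      + 0                  ∎
      where open ≈-Reasoning
    winning : ∀ i → π′ i + (A G′ · (λ j → x (e j))) i ≈ + 0
    winning i = begin
      π′ i + S                               ≡⟨ cong (_+_ (π′ i)) (trans (cong (_+ S) (ℤ.*-zeroʳ (A G (e i) v))) (ℤ.+-identityˡ S)) ⟨
      π′ i + (A G (e i) v * + 0 + S)         ≈⟨ +-cong (≈-refl {π′ i}) (+-cong (*-congˡ (A G (e i) v) xv≈0) (≈-refl {S})) ⟨
      π′ i + (A G (e i) v * x v + S)         ≡⟨ cong₂ _+_ (extend-enumerate (+ 0) (+ 0) π′ (suc (suc i))) (·-row-e x i) ⟨
      π (e i) + (A G · x) (e i)              ≈⟨ won wx (e i) ⟩
      + 0                                    ∎
      where
      open ≈-Reasoning
      S : ℤ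
      S = (A G′ · (λ j → x (e j))) i
    x∘e-wins : Wins (A G′) π′ (λ j → x (e j))
    x∘e-wins = wins winning

  A-AW-induced⇒A-AW : A-AW ℓ G′ → A-AW ℓ G
  A-AW-induced⇒A-AW aw′ π = Wins⇒Winnable x-wins
    where
    xv : ℤ
    xv = - π p
    π′ : Labeling m
    π′ i = π (e i) + A G (e i) v * xv
    y : Fin m → ℤ
    y = proj₁ (aw′ π′)
    wy : Wins (A G′) π′ y
    wy = Winnable⇒Wins {π = π′} (aw′ π′)
    Sv : ℤ
    Sv = sumFin m (λ i → A G v (e i) * y i)
    xp : ℤ
    xp = - (π v + Sv)
    x : Fin n → ℤ
    x = extend xp xv y
    x∘e≗y : ∀ i → x (e i) ≡ y i
    x∘e≗y i = extend-enumerate xp xv y (suc (suc i))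
    cancel : ∀ a s → a + (- (a + s) + s) ≡ + 0
    cancel = solve-∀
    winning : ∀ k → π (enumerate k) + (A G · x) (enumerate k) ≈ + 0
    winning zero = ≈-reflexive (begin
      π p + (A G · x) p   ≡⟨ cong (_+_ (π p)) (trans (·-row-p x) (extend-enumerate xp xv y (suc zero))) ⟩
      π p + - π p         ≡⟨ ℤ.+-inverseʳ (π p) ⟩
      + 0                 ∎)
      where open ≡-Reasoning
    winning (suc zero) = ≈-reflexive (begin
      π v + (A G · x) v                                     ≡⟨ cong (_+_ (π v)) (·-row-v x) ⟩
      π v + (x p + sumFin m (λ i → A G v (e i) * x (e i)))  ≡⟨ cong₂ (λ a s → π v + (a + s)) (extend-enumerate xp xv y zero)
                                                                 (sumFin-cong m (λ i → cong (A G v (e i) *_) (x∘e≗y i))) ⟩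
      π v + (xp + Sv)                                       ≡⟨ cancel (π v) Sv ⟩
      + 0                                                   ∎)
      where open ≡-Reasoning
    winning (suc (suc i)) = begin
      π (e i) + (A G · x) (e i)                                      ≡⟨ cong (_+_ (π (e i))) (·-row-e x i) ⟩
      π (e i) + (A G (e i) v * x v + (A G′ · (λ j → x (e j))) i)     ≡⟨ cong₂ (λ a s → π (e i) + (A G (e i) v * a + s))
                                                                          (extend-enumerate xp xv y (suc zero)) (·-cong (A G′) x∘e≗y i) ⟩
      π (e i) + (A G (e i) v * xv + (A G′ · y) i)                    ≡⟨ ℤ.+-assoc (π (e i)) _ _ ⟨
      π′ i + (A G′ · y) i                                            ≈⟨ won wy i ⟩
      + 0                                                            ∎
      where open ≈-Reasoning
    x-wins : Wins (A G) π x
    x-wins = wins λ w → subst (λ w → π w + (A G · x) w ≈ + 0) (enumerate-index w) (winning (index w))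

  A-AW⇔A-AW-induced : A-AW ℓ G ⇔ A-AW ℓ G′
  A-AW⇔A-AW-induced = mk⇔ A-AW⇒A-AW-induced A-AW-induced⇒A-AW

N-complement : ∀ {n} (G : Graph n) i j → N (complement G) i j ≡ + 1 - A G i j
N-complement G i j with i ≟ j
... | yes refl rewrite adj-irr G i = refl
... | no _ with adj G i j
...   | true  = refl
...   | false = refl

·-complement : ∀ {n} (G : Graph n) (y : Fin n → ℤ) i →
  (N (complement G) · y) i ≡ sumFin n y - (A G · y) i
·-complement {n} G y i = begin
  sumFin n (λ j → N (complement G) i j * y j)        ≡⟨ sumFin-cong n (λ j → trans (cong (_* y j) (N-complement G i j)) (expand (A G i j) (y j))) ⟩
  sumFin n (λ j → + 1 * y j + - + 1 * (A G i j * y j)) ≡⟨ sumFin-linear n (+ 1) (- + 1) y _ ⟩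
  + 1 * sumFin n y + - + 1 * (A G · y) i             ≡⟨ contract (sumFin n y) ((A G · y) i) ⟩
  sumFin n y - (A G · y) i                           ∎
  where
  open ≡-Reasoning
  expand : ∀ a u → (+ 1 - a) * u ≡ + 1 * u + - + 1 * (a * u)
  expand = solve-∀
  contract : ∀ s u → + 1 * s + - + 1 * u ≡ s - u
  contract = solve-∀

ShiftWinnable : ℕ → ∀ {n} → Mat n → Set
ShiftWinnable ℓ {n} M = ∀ (π : Labeling n) → ∃ λ s → Winnable ℓ M (shift π s)

Covering : ℕ → ∀ {n} → Mat n → ℕ → ℤ → Set
Covering ℓ M r t = ∀ z → ∃ λ q → InT ℓ M allV (+ 0) q × ∃ λ x → ((+ r + t) * x) ≡ (z + q) [mod ℓ ]

module ComplementGame (ℓ : ℕ) {n : ℕ} (G : Graph n) where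

  open Game ℓ

  Wins-complement : ∀ {π y} → Wins (N (complement G)) π y ⇔ Wins (A G) (shift π (sumFin n y)) (λ j → - y j)
  Wins-complement {π} {y} = mk⇔ (λ w → wins λ i → subst (_≈ + 0) (same-label i) (won w i))
                                (λ w → wins λ i → subst (_≈ + 0) (sym (same-label i)) (won w i))
    where
    open ≡-Reasoning
    same-label : ∀ i → π i + (N (complement G) · y) i ≡ (π i + sumFin n y) + (A G · (λ j → - y j)) i
    same-label i = begin
      π i + (N (complement G) · y) i        ≡⟨ cong (_+_ (π i)) (·-complement G y i) ⟩
      π i + (sumFin n y - (A G · y) i)      ≡⟨ ℤ.+-assoc (π i) (sumFin n y) _ ⟨
      (π i + sumFin n y) + - (A G · y) i    ≡⟨ cong (_+_ (π i + sumFin n y)) (·-neg (A G) y i) ⟨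
      (π i + sumFin n y) + (A G · (λ j → - y j)) i ∎

  N-AW⇒ShiftWinnable : N-AW ℓ (complement G) → ShiftWinnable ℓ (A G)
  N-AW⇒ShiftWinnable naw π =
    sumFin n (proj₁ (naw π)) , Wins⇒Winnable (Equivalence.to Wins-complement (Winnable⇒Wins {π = π} (naw π)))

  N-AW⇒Covering : ∀ {r} → 1 ≤ r → (∀ r′ → 1 ≤ r′ → r′ < r → ¬ TNonempty ℓ (A G) allV (+ r′)) →
    ∀ {xr t} → Wins (A G) (λ _ → + r) xr → sumFin n xr ≈ t → N-AW ℓ (complement G) → Covering ℓ (A G) r t
  N-AW⇒Covering {r} 1≤r minimal {xr} {t} wr Σxr≈t naw z = sumFin n u , Wins⇒InT wu , k , unmod congruence
    where
    y : Fin n → ℤ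
    y = proj₁ (naw (λ _ → z))
    wy : Wins (A G) (λ _ → z + sumFin n y) (λ j → - y j)
    wy = Equivalence.to Wins-complement (Winnable⇒Wins {π = λ _ → z} (naw (λ _ → z)))
    r∣z+Σy : + r Signed.∣ z + sumFin n y
    r∣z+Σy = Wins-const⇒∣ (A G) 1≤r minimal wr wy
    k : ℤ
    k = Signed.quotient r∣z+Σy
    u : Fin n → ℤ
    u j = + 1 * y j + k * xr j
    wu : Wins (A G) (λ _ → + 0) u
    wu = Wins-resp (λ _ → ≈-reflexive (trans (cong (λ e → - + 1 * e + k * + r) (Signed._∣_.equality r∣z+Σy)) (cancel k (+ r))))
                   (λ j → unnegate k (y j) (xr j))
                   (Wins-linear (- + 1) k wy wr)
      where
      cancel : ∀ k r → - + 1 * (k * r) + k * r ≡ + 0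
      cancel = solve-∀
      unnegate : ∀ k a b → - + 1 * - a + k * b ≡ + 1 * a + k * b
      unnegate = solve-∀
    congruence : (+ r + t) * k ≈ z + sumFin n u
    congruence = begin
      (+ r + t) * k                        ≡⟨ distribute (+ r) t k ⟩
      k * + r + k * t                      ≈⟨ +-cong (≈-refl {k * + r}) (*-congˡ k (≈-sym Σxr≈t)) ⟩
      k * + r + k * sumFin n xr            ≡⟨ cong (λ e → e + k * sumFin n xr) (Signed._∣_.equality r∣z+Σy) ⟨
      (z + sumFin n y) + k * sumFin n xr   ≡⟨ reassociate z (sumFin n y) (k * sumFin n xr) ⟩
      z + (+ 1 * sumFin n y + k * sumFin n xr) ≡⟨ cong (_+_ z) (sumFin-linear n (+ 1) k y xr) ⟨
      z + sumFin n u                       ∎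
      where
      open ≈-Reasoning
      distribute : ∀ a b k → (a + b) * k ≡ k * a + k * b
      distribute = solve-∀
      reassociate : ∀ a b c → (a + b) + c ≡ a + (+ 1 * b + c)
      reassociate = solve-∀

  ShiftWinnable×Covering⇒N-AW : ∀ {r xr t} → Wins (A G) (λ _ → + r) xr → sumFin n xr ≈ t →
    ShiftWinnable ℓ (A G) → Covering ℓ (A G) r t → N-AW ℓ (complement G)
  ShiftWinnable×Covering⇒N-AW {r} {xr} {t} wr Σxr≈t shifts covers π with shifts π
  ... | s , y₀ , w₀ with covers (- s - sumFin n y₀)
  ...   | q , 0∈T , k , hk with InT⇒Wins {M = A G} {r = + 0} 0∈T
  ...     | u , wu , Σu≈q = Wins⇒Winnable wy
    where
    x : Fin n → ℤ
    x j = + 1 * y₀ j + + 1 * (k * xr j + - + 1 * u j)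
    wx : Wins (A G) (λ i → + 1 * (π i + s) + + 1 * (k * + r + - + 1 * + 0)) x
    wx = Wins-linear (+ 1) (+ 1) (Winnable⇒Wins {π = shift π s} (y₀ , w₀)) (Wins-linear k (- + 1) wr wu)
    hk′ : (+ r + t) * k ≈ (- s - sumFin n y₀) + q
    hk′ = mod hk
    Σx : sumFin n x ≡ + 1 * sumFin n y₀ + + 1 * (k * sumFin n xr + - + 1 * sumFin n u)
    Σx = trans (sumFin-linear n (+ 1) (+ 1) y₀ _)
               (cong (λ e → + 1 * sumFin n y₀ + + 1 * e) (sumFin-linear n k (- + 1) xr u))
    simplify : ∀ p s k r t → + 1 * (p + s) + + 1 * (k * r + - + 1 * + 0) ≡ p + ((r + t) * k + (s - k * t))
    simplify = solve-∀
    rearrange : ∀ s Y q k t → ((- s - Y) + q) + (s - k * t) ≡ - Y + (- k * t + q)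
    rearrange = solve-∀
    negate : ∀ Y k X U → - Y + (- k * X + U) ≡ - (+ 1 * Y + + 1 * (k * X + - + 1 * U))
    negate = solve-∀
    labels : ∀ i → + 1 * (π i + s) + + 1 * (k * + r + - + 1 * + 0) ≈ π i + sumFin n (λ j → - x j)
    labels i = begin
      + 1 * (π i + s) + + 1 * (k * + r + - + 1 * + 0)
        ≡⟨ simplify (π i) s k (+ r) t ⟩
      π i + ((+ r + t) * k + (s - k * t))
        ≈⟨ +-cong (≈-refl {π i}) (+-cong hk′ (≈-refl {s - k * t})) ⟩
      π i + (((- s - sumFin n y₀) + q) + (s - k * t))
        ≡⟨ cong (_+_ (π i)) (rearrange s (sumFin n y₀) q k t) ⟩
      π i + (- sumFin n y₀ + (- k * t + q))
        ≈⟨ +-cong (≈-refl {π i}) (+-cong (≈-refl { - sumFin n y₀}) (+-cong (*-congˡ (- k) Σxr≈t) Σu≈q)) ⟨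
      π i + (- sumFin n y₀ + (- k * sumFin n xr + sumFin n u))
        ≡⟨ cong (_+_ (π i)) (negate (sumFin n y₀) k (sumFin n xr) (sumFin n u)) ⟩
      π i + - (+ 1 * sumFin n y₀ + + 1 * (k * sumFin n xr + - + 1 * sumFin n u))
        ≡⟨ cong (λ e → π i + - e) Σx ⟨
      π i + - sumFin n x
        ≡⟨ cong (_+_ (π i)) (sumFin-neg n x) ⟨
      π i + sumFin n (λ j → - x j)
        ∎
      where open ≈-Reasoning
    wy : Wins (N (complement G)) π (λ j → - x j)
    wy = Equivalence.from Wins-complement (Wins-resp labels (λ j → sym (ℤ.neg-involutive (x j))) wx)

theorem3p6 : (ℓ : ℕ) → 2 ≤ ℓ → {n : ℕ} (G : Graph n) (p v : Fin n) →
    PendantWithNeighbor G p v →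
    {m : ℕ} (e : Fin m → Fin n) → EnumeratesWithout e p v →
    (A-AW ℓ G ⇔ A-AW ℓ (induced G e))
    × ((r : ℕ) → 1 ≤ r → TNonempty ℓ (A G) allV (+ r) →
         (∀ r′ → 1 ≤ r′ → r′ < r → ¬ TNonempty ℓ (A G) allV (+ r′)) →
         (t : ℤ) → InT ℓ (A G) allV (+ r) t →
         (N-AW ℓ (complement G)
           ⇔ ((∀ (π : Labeling n) → ∃ λ (s : ℤ) → Winnable ℓ (A G) (shift π s))
              × (∀ (z : ℤ) → ∃ λ (q : ℤ) → InT ℓ (A G) allV (+ 0) q
                   × ∃ λ (x : ℤ) → ((+ r + t) * x) ≡ (z + q) [mod ℓ ]))))
theorem3p6 ℓ _ G p v pendant e enum =
  Pendant.A-AW⇔A-AW-induced ℓ G p v pendant enum ,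
  λ r 1≤r _ minimal t r∈T →
    let (xr , wr , Σxr≈t) = InT⇒Wins {M = A G} {r = + r} r∈T in
    mk⇔ (λ naw → N-AW⇒ShiftWinnable naw , N-AW⇒Covering 1≤r minimal wr Σxr≈t naw)
        (λ (shifts , covers) → ShiftWinnable×Covering⇒N-AW wr Σxr≈t shifts covers)
  where
  open Game ℓ
  open ComplementGame ℓ G
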